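{- For all $n\ge 2$, $\overline{q}_n(132,231)=4\cdot 3^{n-2}$.
   Context: For a positive integer $n$, let $\mathcal{S}_{n,n}$ denote the set of all permutations (words) $\pi=\pi_1\cdots\pi_{2n}$ of the multiset $\{1,1,2,2,\ldots,n,n\}$. A word $\pi$ contains a pattern $\sigma=\sigma_1\cdots\sigma_k$ if there are indices $i_1<\cdots<i_k$ such that $\pi_{i_a}=\pi_{i_b}$ iff $\sigma_a=\sigma_b$ and $\pi_{i_a}<\pi_{i_b}$ iff $\sigma_a<\sigma_b$ for all $a,b$; otherwise $\pi$ avoids $\sigma$. The quasi-Stirling permutations $\overline{\mathcal{Q}}_n$ are the $\pi\in\mathcal{S}_{n,n}$ avoiding both $1212$ and $2121$. For a set $\Lambda$ of patterns, $\overline{\mathcal{Q}}_n(\Lambda)$ is the set of $\pi\in\overline{\mathcal{Q}}_n$ avoiding every pattern in $\Lambda$, and $\overline{q}_n(\Lambda)=|\overline{\mathcal{Q}}_n(\Lambda)|$. -}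

module Defs where

open import Data.Nat using (ℕ; suc; _<_)
open import Data.List using (List; []; _∷_; map; concatMap; upTo)
open import Data.List.Relation.Unary.All using (All)
open import Data.List.Relation.Binary.Sublist.Propositional using (_⊆_)
open import Data.List.Relation.Binary.Permutation.Propositional using (_↭_)
open import Data.Product using (_×_; ∃)
open import Function.Bundles using (_⇔_)
open import Relation.Binary.PropositionalEquality using (_≡_)
open import Relation.Nullary using (¬_)

doubled : ℕ → List ℕ
doubled n = concatMap (λ k → suc k ∷ suc k ∷ []) (upTo n)

IsSnn : ℕ → List ℕ → Set
IsSnn n π = π ↭ doubled n

SameRel : ℕ → ℕ → ℕ → ℕ → Set
SameRel x x' y y' = (x ≡ x' ⇔ y ≡ y') × (x < x' ⇔ y < y') × (x' < x ⇔ y' < y)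

-- OrderIso s σ : s and σ have the same length and for all positions a,b
-- the relations between entries agree (a = b is trivial).
data OrderIso : List ℕ → List ℕ → Set where
  []  : OrderIso [] []
  _∷_ : ∀ {x y xs ys} →
        All (λ p → SameRel x (Data.Product.proj₁ p) y (Data.Product.proj₂ p))
            (Data.List.zip xs ys) →
        OrderIso xs ys → OrderIso (x ∷ xs) (y ∷ ys)

Contains : List ℕ → List ℕ → Set
Contains π σ = ∃ λ s → s ⊆ π × OrderIso s σ

Avoids : List ℕ → List ℕ → Set
Avoids π σ = ¬ Contains π σ

p1212 p2121 p132 p231 : List ℕ
p1212 = 1 ∷ 2 ∷ 1 ∷ 2 ∷ []
p2121 = 2 ∷ 1 ∷ 2 ∷ 1 ∷ []
p132  = 1 ∷ 3 ∷ 2 ∷ []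
p231  = 2 ∷ 3 ∷ 1 ∷ []

IsQuasiStirling : ℕ → List ℕ → Set
IsQuasiStirling n π = IsSnn n π × Avoids π p1212 × Avoids π p2121

InQbar : ℕ → List (List ℕ) → List ℕ → Set
InQbar n Λ π = IsQuasiStirling n π × All (Avoids π) Λ

module Submission where

-- Avoiding 132 and 231 means that no letter has a smaller letter on each side unless these two
-- are equal. Write π ∈ Q̄_n(132,231) with n ≥ 3 as A n B n C: every letter of A must equal every
-- letter of B C, and every letter of A B every letter of C. Since π contains the distinct letters
-- 1 and 2, this forces π to be n n σ, σ n n or n σ n with σ ∈ Q̄_{n-1}(132,231); conversely these
-- three insertions of a new maximum always stay in the class, and they are pairwise distinct and
-- recover σ by erasing n. Hence the count triples at each step, starting from the four words
-- 1221, 2211, 1122, 2112 for n = 2.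

open import Defs
open import Data.Nat using (ℕ; zero; suc; _+_; _≤_; _<_; _*_; _^_; _∸_; z≤n; s≤s; z<s; s<s; _≟_; _<?_)
open import Data.Nat.Properties
  using (<-irrefl; <-asym; <-cmp; <⇒≢; <⇒≤; ≤-refl; n≮n; <-≤-trans; m<n⇒m<1+n; *-suc; *-assoc)
open import Data.List using (List; []; _∷_; length; _++_; reverse; concatMap; upTo; filter)
open import Data.List.Properties
  using (reverse-involutive; reverse-++; ++-assoc; ++-identityʳ; upTo-∷ʳ; concatMap-++;
         ∷-injectiveˡ; ∷-injectiveʳ; filter-all; filter-reject; filter-++)
open import Data.List.Relation.Unary.All using (All; []; _∷_)
import Data.List.Relation.Unary.All as All
open import Data.List.Relation.Unary.All.Properties using (++⁺; concat⁺) renaming (map⁺ to All-map⁺)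
open import Data.List.Relation.Unary.Any using (here; there)
open import Data.List.Relation.Unary.AllPairs using ([]; _∷_)
open import Data.List.Relation.Unary.Unique.Propositional using (Unique)
open import Data.List.Relation.Unary.Unique.Propositional.Properties using () renaming (++⁺ to Unique-++⁺)
open import Data.List.Relation.Binary.Disjoint.Propositional using (Disjoint)
open import Data.List.Membership.Propositional using (_∈_; find; lose)
open import Data.List.Membership.Propositional.Properties
  using (∈-∃++; ∈-++⁺ˡ; ∈-++⁺ʳ; ∈-++⁻; ∈-concatMap⁺; ∈-concatMap⁻)
open import Data.List.Relation.Binary.Sublist.Propositional
  using (_⊆_; []; _∷_; _∷ʳ_; ⊆-refl; ⊆-trans; from∈)
open import Data.List.Relation.Binary.Sublist.Propositional.Properties
  using (All-resp-⊆; reverse⁺; reverse⁻) renaming (++⁺ to ⊆-++⁺)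
open import Data.List.Relation.Binary.Sublist.DecPropositional _≟_ using (_⊆?_)
open import Data.List.Relation.Binary.Permutation.Propositional using (_↭_; ↭-sym; ↭-trans; ↭-refl; prep)
open import Data.List.Relation.Binary.Permutation.Propositional.Properties
  using (All-resp-↭; ∈-resp-↭; ↭-reverse; drop-mid; shift; ++-comm; ↭-length) renaming (++⁺ʳ to ↭-++⁺ʳ)
open import Data.Product using (Σ; _×_; _,_; proj₁; proj₂; ∃)
open import Data.Sum using (_⊎_; inj₁; inj₂)
open import Data.Empty using (⊥-elim)
open import Function.Bundles using (_⇔_; mk⇔; Equivalence)
open import Relation.Binary using (tri<; tri≈; tri>)
open import Relation.Binary.PropositionalEquality using (_≡_; _≢_; refl; sym; trans; cong; cong₂; subst; module ≡-Reasoning)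
open import Relation.Nullary using (¬_)
open import Relation.Nullary.Decidable using (decidable-stable; from-no)

open Equivalence using (from; to)

private
  variable
    m n x y : ℕ
    π σ τ : List ℕ

1<2 : 1 < 2
1<2 = s<s z<s

1<3 : 1 < 3
1<3 = s<s z<s

2<3 : 2 < 3
2<3 = s<s (s<s z<s)

sameRel-< : ∀ {x x' y y'} → x < x' → y < y' → SameRel x x' y y'
sameRel-< x<x' y<y' =
  mk⇔ (λ x≡x' → ⊥-elim (<-irrefl x≡x' x<x')) (λ y≡y' → ⊥-elim (<-irrefl y≡y' y<y')) ,
  mk⇔ (λ _ → y<y') (λ _ → x<x') ,
  mk⇔ (λ x'<x → ⊥-elim (<-asym x<x' x'<x)) (λ y'<y → ⊥-elim (<-asym y<y' y'<y))

sameRel-> : ∀ {x x' y y'} → x' < x → y' < y → SameRel x x' y y'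
sameRel-> x'<x y'<y =
  mk⇔ (λ x≡x' → ⊥-elim (<-irrefl (sym x≡x') x'<x)) (λ y≡y' → ⊥-elim (<-irrefl (sym y≡y') y'<y)) ,
  mk⇔ (λ x<x' → ⊥-elim (<-asym x'<x x<x')) (λ y<y' → ⊥-elim (<-asym y'<y y<y')) ,
  mk⇔ (λ _ → y'<y) (λ _ → x'<x)

sameRel-≡ : SameRel x x y y
sameRel-≡ =
  mk⇔ (λ _ → refl) (λ _ → refl) ,
  mk⇔ (λ y<y → ⊥-elim (n≮n _ y<y)) (λ x<x → ⊥-elim (n≮n _ x<x)) ,
  mk⇔ (λ y<y → ⊥-elim (n≮n _ y<y)) (λ x<x → ⊥-elim (n≮n _ x<x))

module _ {x x' y y' : ℕ} (r : SameRel x x' y y') where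

  reflect-≡ : y ≡ y' → x ≡ x'
  reflect-≡ = from (proj₁ r)

  reflect-< : y < y' → x < x'
  reflect-< = from (proj₁ (proj₂ r))

  reflect-> : y' < y → x' < x
  reflect-> = from (proj₂ (proj₂ r))

PeakFree : List ℕ → Set
PeakFree π = ∀ {a b c} → a < b → c < b → a ≢ c → ¬ (a ∷ b ∷ c ∷ []) ⊆ π

AlternationFree : List ℕ → Set
AlternationFree π = ∀ {x y} → x ≢ y → ¬ (x ∷ y ∷ x ∷ y ∷ []) ⊆ π

Admissible : List ℕ → Set
Admissible π = PeakFree π × AlternationFree π

peakFree⇒avoids-132 : PeakFree π → Avoids π p132
peakFree⇒avoids-132 pf (_ , sub , (ab ∷ ac ∷ []) ∷ (bc ∷ []) ∷ [] ∷ []) =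
  pf (reflect-< ab 1<3) (reflect-> bc 2<3) (<⇒≢ (reflect-< ac 1<2)) sub

peakFree⇒avoids-231 : PeakFree π → Avoids π p231
peakFree⇒avoids-231 pf (_ , sub , (ab ∷ ac ∷ []) ∷ (bc ∷ []) ∷ [] ∷ []) =
  pf (reflect-< ab 2<3) (reflect-> bc 1<3) (λ a≡c → <⇒≢ (reflect-> ac 1<2) (sym a≡c)) sub

avoids-132-231⇒peakFree : Avoids π p132 → Avoids π p231 → PeakFree π
avoids-132-231⇒peakFree a132 a231 {a} {b} {c} a<b c<b a≢c sub with <-cmp a c
... | tri< a<c _ _ =
  a132 (_ , sub , (sameRel-< a<b 1<3 ∷ sameRel-< a<c 1<2 ∷ []) ∷ (sameRel-> c<b 2<3 ∷ []) ∷ [] ∷ [])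
... | tri≈ _ a≡c _ = a≢c a≡c
... | tri> _ _ c<a =
  a231 (_ , sub , (sameRel-< a<b 2<3 ∷ sameRel-> c<a 1<2 ∷ []) ∷ (sameRel-> c<b 1<3 ∷ []) ∷ [] ∷ [])

alternationFree⇒avoids-1212 : AlternationFree π → Avoids π p1212
alternationFree⇒avoids-1212 af (_ , sub , (ab ∷ ac ∷ _ ∷ []) ∷ (_ ∷ bd ∷ []) ∷ _ ∷ [] ∷ [])
  with reflect-≡ ac refl | reflect-≡ bd refl
... | refl | refl = af (<⇒≢ (reflect-< ab 1<2)) sub

alternationFree⇒avoids-2121 : AlternationFree π → Avoids π p2121
alternationFree⇒avoids-2121 af (_ , sub , (ab ∷ ac ∷ _ ∷ []) ∷ (_ ∷ bd ∷ []) ∷ _ ∷ [] ∷ [])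
  with reflect-≡ ac refl | reflect-≡ bd refl
... | refl | refl = af (λ a≡b → <⇒≢ (reflect-> ab 1<2) (sym a≡b)) sub

avoids-1212-2121⇒alternationFree : Avoids π p1212 → Avoids π p2121 → AlternationFree π
avoids-1212-2121⇒alternationFree a1212 a2121 {x} {y} x≢y sub with <-cmp x y
... | tri< x<y _ _ =
  a1212 (_ , sub , (sameRel-< x<y 1<2 ∷ sameRel-≡ ∷ sameRel-< x<y 1<2 ∷ []) ∷
                   (sameRel-> x<y 1<2 ∷ sameRel-≡ ∷ []) ∷ (sameRel-< x<y 1<2 ∷ []) ∷ [] ∷ [])
... | tri≈ _ x≡y _ = x≢y x≡y
... | tri> _ _ y<x =
  a2121 (_ , sub , (sameRel-> y<x 1<2 ∷ sameRel-≡ ∷ sameRel-> y<x 1<2 ∷ []) ∷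
                   (sameRel-< y<x 1<2 ∷ sameRel-≡ ∷ []) ∷ (sameRel-> y<x 1<2 ∷ []) ∷ [] ∷ [])

inQbar⇔admissible : InQbar n (p132 ∷ p231 ∷ []) π ⇔ (π ↭ doubled n × Admissible π)
inQbar⇔admissible = mk⇔
  (λ { ((π↭ , a1212 , a2121) , a132 ∷ a231 ∷ []) →
         π↭ , avoids-132-231⇒peakFree a132 a231 , avoids-1212-2121⇒alternationFree a1212 a2121 })
  (λ (π↭ , pf , af) →
     (π↭ , alternationFree⇒avoids-1212 af , alternationFree⇒avoids-2121 af) ,
     peakFree⇒avoids-132 pf ∷ peakFree⇒avoids-231 pf ∷ [])

peakFree-⊆ : σ ⊆ π → PeakFree π → PeakFree σ
peakFree-⊆ σ⊆π pf a<b c<b a≢c sub = pf a<b c<b a≢c (⊆-trans sub σ⊆π)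

admissible-⊆ : σ ⊆ π → Admissible π → Admissible σ
admissible-⊆ σ⊆π (pf , af) = peakFree-⊆ σ⊆π pf , λ x≢y sub → af x≢y (⊆-trans sub σ⊆π)

admissible-reverse : Admissible π → Admissible (reverse π)
admissible-reverse (pf , af) =
  (λ {a} {b} {c} a<b c<b a≢c sub → pf c<b a<b (λ c≡a → a≢c (sym c≡a)) (reverse⁻ {as = c ∷ b ∷ a ∷ []} sub)) ,
  (λ {x} {y} x≢y sub → af (λ y≡x → x≢y (sym y≡x)) (reverse⁻ {as = y ∷ x ∷ y ∷ x ∷ []} sub))

admissible-reverse⁻ : Admissible (reverse π) → Admissible π
admissible-reverse⁻ {π} adm = subst Admissible (reverse-involutive π) (admissible-reverse adm)

max-absent : ∀ {zs} → All (_< m) σ → ¬ (y ∷ m ∷ zs) ⊆ σ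
max-absent σ<m sub with All-resp-⊆ sub σ<m
... | _ ∷ m<m ∷ _ = n≮n _ m<m

¬y-m-y⊆m∷ : All (_< m) σ → y ≢ m → ¬ (y ∷ m ∷ y ∷ []) ⊆ (m ∷ σ)
¬y-m-y⊆m∷ σ<m y≢m (_ ∷ʳ sub) = max-absent σ<m sub
¬y-m-y⊆m∷ σ<m y≢m (refl ∷ _) = y≢m refl

-- An alternation m y m y starting at the new front letter would leave y m y in τ.
admissible-∷ : All (_≤ m) τ → (∀ {y} → y ≢ m → ¬ (y ∷ m ∷ y ∷ []) ⊆ τ) → Admissible τ →
               Admissible (m ∷ τ)
admissible-∷ τ≤m no-ymy (pf , af) = peakFree , alternationFree
  where
  peakFree : PeakFree (_ ∷ _)
  peakFree a<b c<b a≢c (_ ∷ʳ sub) = pf a<b c<b a≢c sub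
  peakFree a<b c<b a≢c (refl ∷ sub) with All-resp-⊆ sub τ≤m
  ... | b≤m ∷ _ = n≮n _ (<-≤-trans a<b b≤m)
  alternationFree : AlternationFree (_ ∷ _)
  alternationFree x≢y (_ ∷ʳ sub) = af x≢y sub
  alternationFree x≢y (refl ∷ sub) = no-ymy (λ y≡x → x≢y (sym y≡x)) sub

admissible-m∷ : All (_< m) σ → Admissible σ → Admissible (m ∷ σ)
admissible-m∷ σ<m = admissible-∷ (All.map <⇒≤ σ<m) (λ _ → max-absent σ<m)

admissible-mm∷ : All (_< m) σ → Admissible σ → Admissible (m ∷ m ∷ σ)
admissible-mm∷ σ<m adm =
  admissible-∷ (≤-refl ∷ All.map <⇒≤ σ<m) (¬y-m-y⊆m∷ σ<m) (admissible-m∷ σ<m adm)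

All-reverse : ∀ {P : ℕ → Set} → All P σ → All P (reverse σ)
All-reverse {σ} = All-resp-↭ (↭-sym (↭-reverse σ))

admissible-∷ʳmm : All (_< m) σ → Admissible σ → Admissible (σ ++ m ∷ m ∷ [])
admissible-∷ʳmm {m} {σ} σ<m adm = admissible-reverse⁻
  (subst Admissible (sym (reverse-++ σ (m ∷ m ∷ [])))
         (admissible-mm∷ (All-reverse σ<m) (admissible-reverse adm)))

admissible-m∷∷ʳm : All (_< m) σ → Admissible σ → Admissible (m ∷ σ ++ m ∷ [])
admissible-m∷∷ʳm {m} {σ} σ<m adm =
  admissible-∷ (++⁺ (All.map <⇒≤ σ<m) (≤-refl ∷ [])) no-ymy admissible-∷ʳm
  where
  reverse-∷ʳm : reverse (σ ++ m ∷ []) ≡ m ∷ reverse σ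
  reverse-∷ʳm = reverse-++ σ (m ∷ [])
  admissible-∷ʳm : Admissible (σ ++ m ∷ [])
  admissible-∷ʳm = admissible-reverse⁻ (subst Admissible (sym reverse-∷ʳm)
                     (admissible-m∷ (All-reverse σ<m) (admissible-reverse adm)))
  no-ymy : y ≢ m → ¬ (y ∷ m ∷ y ∷ []) ⊆ (σ ++ m ∷ [])
  no-ymy {y} y≢m sub = ¬y-m-y⊆m∷ (All-reverse σ<m) y≢m
    (subst ((y ∷ m ∷ y ∷ []) ⊆_) reverse-∷ʳm (reverse⁺ sub))

doubled-suc : ∀ n → doubled (suc n) ≡ doubled n ++ suc n ∷ suc n ∷ []
doubled-suc n = trans (cong (concatMap (λ k → suc k ∷ suc k ∷ [])) (sym (upTo-∷ʳ n)))
                      (concatMap-++ (λ k → suc k ∷ suc k ∷ []) (upTo n) (n ∷ []))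

doubled-< : ∀ n → All (_< suc n) (doubled n)
doubled-< zero = []
doubled-< (suc n) rewrite doubled-suc n =
  ++⁺ (All.map m<n⇒m<1+n (doubled-< n)) (≤-refl ∷ ≤-refl ∷ [])

1∈doubled : ∀ n → 1 ∈ doubled (suc n)
1∈doubled zero = here refl
1∈doubled (suc n) rewrite doubled-suc (suc n) = ∈-++⁺ˡ (1∈doubled n)

2∈doubled : ∀ n → 2 ∈ doubled (2 + n)
2∈doubled zero = there (there (here refl))
2∈doubled (suc n) rewrite doubled-suc (2 + n) = ∈-++⁺ˡ (2∈doubled n)

insertions : ℕ → List ℕ → List (List ℕ)
insertions m σ = (m ∷ m ∷ σ) ∷ (σ ++ m ∷ m ∷ []) ∷ (m ∷ σ ++ m ∷ []) ∷ []

insertions-↭ : ∀ m σ → All (_↭ σ ++ m ∷ m ∷ []) (insertions m σ)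
insertions-↭ m σ = ++-comm (m ∷ m ∷ []) σ ∷ ↭-refl ∷ ↭-sym (shift m σ (m ∷ [])) ∷ []

admissible-insertions : All (_< m) σ → Admissible σ → All Admissible (insertions m σ)
admissible-insertions σ<m adm =
  admissible-mm∷ σ<m adm ∷ admissible-∷ʳmm σ<m adm ∷ admissible-m∷∷ʳm σ<m adm ∷ []

insertion-step : σ ↭ doubled n × Admissible σ →
                 All (λ w → w ↭ doubled (suc n) × Admissible w) (insertions (suc n) σ)
insertion-step {σ} {n} (σ↭ , adm) =
  All.zipWith (λ (w↭ , w-adm) → ↭-trans w↭ σ++mm↭ , w-adm)
              (insertions-↭ (suc n) σ , admissible-insertions σ<m adm)
  where
  σ<m : All (_< suc n) σ
  σ<m = All-resp-↭ (↭-sym σ↭) (doubled-< n)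
  σ++mm↭ : σ ++ suc n ∷ suc n ∷ [] ↭ doubled (suc n)
  σ++mm↭ = subst (σ ++ suc n ∷ suc n ∷ [] ↭_) (sym (doubled-suc n)) (↭-++⁺ʳ _ σ↭)

peakFree-twoValued : ∀ {p q} → All (λ x → x ≡ p ⊎ x ≡ q) π → PeakFree π
peakFree-twoValued values a<b c<b a≢c sub with All-resp-⊆ sub values
... | inj₁ refl ∷ inj₁ refl ∷ _ ∷ [] = n≮n _ a<b
... | inj₂ refl ∷ inj₂ refl ∷ _ ∷ [] = n≮n _ a<b
... | _ ∷ inj₁ refl ∷ inj₁ refl ∷ [] = n≮n _ c<b
... | _ ∷ inj₂ refl ∷ inj₂ refl ∷ [] = n≮n _ c<b
... | inj₁ refl ∷ _ ∷ inj₁ refl ∷ [] = a≢c refl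
... | inj₂ refl ∷ _ ∷ inj₂ refl ∷ [] = a≢c refl

admissible-11 : Admissible (1 ∷ 1 ∷ [])
admissible-11 = peakFree-twoValued {q = 1} (All.map inj₁ ones) , alternationFree
  where
  ones : All (_≡ 1) (1 ∷ 1 ∷ [])
  ones = refl ∷ refl ∷ []
  alternationFree : AlternationFree (1 ∷ 1 ∷ [])
  alternationFree x≢y sub with All-resp-⊆ sub ones
  ... | refl ∷ refl ∷ _ = x≢y refl

admissible-1221 : Admissible (1 ∷ 2 ∷ 2 ∷ 1 ∷ [])
admissible-1221 = peakFree-twoValued values , alternationFree
  where
  values : All (λ x → x ≡ 1 ⊎ x ≡ 2) (1 ∷ 2 ∷ 2 ∷ 1 ∷ [])
  values = inj₁ refl ∷ inj₂ refl ∷ inj₂ refl ∷ inj₁ refl ∷ []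
  alternationFree : AlternationFree (1 ∷ 2 ∷ 2 ∷ 1 ∷ [])
  alternationFree x≢y sub with All-resp-⊆ sub values
  ... | inj₁ refl ∷ inj₁ refl ∷ _ = x≢y refl
  ... | inj₂ refl ∷ inj₂ refl ∷ _ = x≢y refl
  ... | inj₁ refl ∷ inj₂ refl ∷ _ = from-no ((1 ∷ 2 ∷ 1 ∷ 2 ∷ []) ⊆? (1 ∷ 2 ∷ 2 ∷ 1 ∷ [])) sub
  ... | inj₂ refl ∷ inj₁ refl ∷ _ = from-no ((2 ∷ 1 ∷ 2 ∷ 1 ∷ []) ⊆? (1 ∷ 2 ∷ 2 ∷ 1 ∷ [])) sub

-- qbar k lists Q̄_{k+2}(132,231).
qbar : ℕ → List (List ℕ)
qbar zero = (1 ∷ 2 ∷ 2 ∷ 1 ∷ []) ∷ insertions 2 (1 ∷ 1 ∷ [])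
qbar (suc k) = concatMap (insertions (3 + k)) (qbar k)

qbar-sound : ∀ k → All (λ π → π ↭ doubled (2 + k) × Admissible π) (qbar k)
qbar-sound zero =
  (prep 1 (shift 1 (2 ∷ 2 ∷ []) []) , admissible-1221) ∷ insertion-step {n = 1} (↭-refl , admissible-11)
qbar-sound (suc k) = concat⁺ (All-map⁺ (All.map insertion-step (qbar-sound k)))

↭-split : ∀ {ρ} → π ↭ τ ++ m ∷ ρ → ∃ λ P → ∃ λ Q → π ≡ P ++ m ∷ Q × P ++ Q ↭ τ ++ ρ
↭-split {τ = τ} π↭ with ∈-∃++ (∈-resp-↭ (↭-sym π↭) (∈-++⁺ʳ τ (here refl)))
... | P , Q , refl = P , Q , refl , drop-mid P τ π↭

drop-last : ∀ A {B} → A ++ m ∷ B ↭ τ ++ m ∷ [] → A ++ B ↭ τ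
drop-last {τ = τ} A A++m∷B↭ = subst (_ ↭_) (++-identityʳ τ) (drop-mid A τ A++m∷B↭)

split-copies : π ↭ τ ++ m ∷ m ∷ [] →
               ∃ λ A → ∃ λ B → ∃ λ C → π ≡ A ++ m ∷ B ++ m ∷ C × A ++ B ++ C ↭ τ
split-copies {τ = τ} {m} π↭ with ↭-split π↭
... | P , Q , refl , PQ↭ with ∈-++⁻ P (∈-resp-↭ (↭-sym PQ↭) (∈-++⁺ʳ τ (here refl)))
... | inj₁ m∈P with ∈-∃++ m∈P
...   | A , B , refl = A , B , Q , ++-assoc A (m ∷ B) (m ∷ Q) ,
          drop-last A (subst (_↭ τ ++ m ∷ []) (++-assoc A (m ∷ B) Q) PQ↭)
split-copies {τ = τ} {m} π↭ | P , Q , refl , PQ↭ | inj₂ m∈Q with ∈-∃++ m∈Q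
...   | B , C , refl = P , B , C , refl ,
          subst (_↭ τ) (++-assoc P B C)
            (drop-last (P ++ B) (subst (_↭ τ ++ m ∷ []) (sym (++-assoc P B (m ∷ C))) PQ↭))

cross-equal⇒one-empty : ∀ U V → (∀ {u v} → u ∈ U → v ∈ V → u ≡ v) →
                        x ∈ U ++ V → y ∈ U ++ V → x ≢ y → U ≡ [] ⊎ V ≡ []
cross-equal⇒one-empty [] V _ _ _ _ = inj₁ refl
cross-equal⇒one-empty (u ∷ U) [] _ _ _ _ = inj₂ refl
cross-equal⇒one-empty (u ∷ U) (v ∷ V) cross x∈ y∈ x≢y = ⊥-elim (x≢y (trans (≡u x∈) (sym (≡u y∈))))
  where
  ≡u : ∀ {w} → w ∈ (u ∷ U) ++ (v ∷ V) → w ≡ u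
  ≡u w∈ with ∈-++⁻ (u ∷ U) w∈
  ... | inj₁ w∈U = trans (cross w∈U (here refl)) (sym (cross (here refl) (here refl)))
  ... | inj₂ w∈V = sym (cross (here refl) w∈V)

peakFree⇒cross-equal : ∀ X Y → All (_< m) (X ++ Y) → PeakFree (X ++ m ∷ Y) →
                       ∀ {u v} → u ∈ X → v ∈ Y → u ≡ v
peakFree⇒cross-equal X Y XY<m pf u∈X v∈Y = decidable-stable (_ ≟ _) λ u≢v →
  pf (All.lookup XY<m (∈-++⁺ˡ u∈X)) (All.lookup XY<m (∈-++⁺ʳ X v∈Y)) u≢v
     (⊆-++⁺ (from∈ u∈X) (refl ∷ from∈ v∈Y))

blocks-∈insertions : ∀ A B C → A ≡ [] ⊎ B ++ C ≡ [] → A ++ B ≡ [] ⊎ C ≡ [] →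
                     A ++ m ∷ B ++ m ∷ C ∈ insertions m (A ++ B ++ C)
blocks-∈insertions [] [] C _ (inj₁ refl) = here refl
blocks-∈insertions [] B [] _ (inj₂ refl) rewrite ++-identityʳ B = there (there (here refl))
blocks-∈insertions A [] [] (inj₂ refl) _ rewrite ++-identityʳ A = there (here refl)
blocks-∈insertions (_ ∷ _) _ _ (inj₁ ()) _
blocks-∈insertions (_ ∷ _) (_ ∷ _) _ (inj₂ ()) _
blocks-∈insertions (_ ∷ _) [] (_ ∷ _) (inj₂ ()) _

peakFree⇒∈insertions : ∀ A B C → All (_< m) (A ++ B ++ C) →
                       x ∈ A ++ B ++ C → y ∈ A ++ B ++ C → x ≢ y → PeakFree (A ++ m ∷ B ++ m ∷ C) →
                       A ++ m ∷ B ++ m ∷ C ∈ insertions m (A ++ B ++ C)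
peakFree⇒∈insertions {m} {x} {y} A B C ABC<m x∈ y∈ x≢y pf = blocks-∈insertions A B C
  (cross-equal⇒one-empty A (B ++ C)
     (peakFree⇒cross-equal A (B ++ C) ABC<m (peakFree-⊆ drop-second pf)) x∈ y∈ x≢y)
  (cross-equal⇒one-empty (A ++ B) C
     (peakFree⇒cross-equal (A ++ B) C (reassoc {All (_< m)} ABC<m) (peakFree-⊆ drop-first pf))
     (reassoc {x ∈_} x∈) (reassoc {y ∈_} y∈) x≢y)
  where
  reassoc : ∀ {P : List ℕ → Set} → P (A ++ B ++ C) → P ((A ++ B) ++ C)
  reassoc {P} = subst P (sym (++-assoc A B C))
  drop-second : A ++ m ∷ B ++ C ⊆ A ++ m ∷ B ++ m ∷ C
  drop-second = ⊆-++⁺ ⊆-refl (refl ∷ ⊆-++⁺ ⊆-refl (m ∷ʳ ⊆-refl))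
  drop-first : (A ++ B) ++ m ∷ C ⊆ A ++ m ∷ B ++ m ∷ C
  drop-first = subst (_⊆ A ++ m ∷ B ++ m ∷ C) (sym (++-assoc A B (m ∷ C)))
                     (⊆-++⁺ ⊆-refl (m ∷ʳ ⊆-refl))

↭-xx⇒≡ : ∀ {xs} → xs ↭ x ∷ x ∷ [] → xs ≡ x ∷ x ∷ []
↭-xx⇒≡ {x} {xs} xs↭ = all-x xs (All-resp-↭ (↭-sym xs↭) (refl ∷ refl ∷ [])) (↭-length xs↭)
  where
  all-x : ∀ xs → All (_≡ x) xs → length xs ≡ 2 → xs ≡ x ∷ x ∷ []
  all-x (_ ∷ _ ∷ []) (refl ∷ refl ∷ []) _ = refl
  all-x [] _ ()
  all-x (_ ∷ []) _ ()
  all-x (_ ∷ _ ∷ _ ∷ _) _ ()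

qbar₀-complete : ∀ A B C → A ++ B ++ C ≡ 1 ∷ 1 ∷ [] → AlternationFree (A ++ 2 ∷ B ++ 2 ∷ C) →
                 A ++ 2 ∷ B ++ 2 ∷ C ∈ qbar 0
qbar₀-complete (_ ∷ []) [] (_ ∷ []) refl _ = here refl
qbar₀-complete [] [] (_ ∷ _ ∷ []) refl _ = there (here refl)
qbar₀-complete (_ ∷ _ ∷ []) [] [] refl _ = there (there (here refl))
qbar₀-complete [] (_ ∷ _ ∷ []) [] refl _ = there (there (there (here refl)))
qbar₀-complete [] (_ ∷ []) (_ ∷ []) refl af = ⊥-elim (af (λ ()) ⊆-refl)
qbar₀-complete (_ ∷ []) (_ ∷ []) [] refl af = ⊥-elim (af (λ ()) ⊆-refl)

qbar-complete : ∀ k → π ↭ doubled (2 + k) → Admissible π → π ∈ qbar k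
qbar-complete zero π↭ (_ , af) with split-copies {τ = 1 ∷ 1 ∷ []} π↭
... | A , B , C , refl , ABC↭ = qbar₀-complete A B C (↭-xx⇒≡ ABC↭) af
qbar-complete {π} (suc k) π↭ adm with split-copies {m = 3 + k} (subst (π ↭_) (doubled-suc (2 + k)) π↭)
... | A , B , C , refl , ABC↭ = ∈-concatMap⁺ (insertions (3 + k)) (lose (qbar-complete k ABC↭ (admissible-⊆ drop-both adm))
                                                 (peakFree⇒∈insertions A B C ABC<m 1∈ 2∈ (λ ()) (proj₁ adm)))
  where
  ABC<m : All (_< 3 + k) (A ++ B ++ C)
  ABC<m = All-resp-↭ (↭-sym ABC↭) (doubled-< (2 + k))
  1∈ : 1 ∈ A ++ B ++ C
  1∈ = ∈-resp-↭ (↭-sym ABC↭) (1∈doubled (1 + k))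
  2∈ : 2 ∈ A ++ B ++ C
  2∈ = ∈-resp-↭ (↭-sym ABC↭) (2∈doubled k)
  drop-both : A ++ B ++ C ⊆ A ++ (3 + k) ∷ B ++ (3 + k) ∷ C
  drop-both = ⊆-++⁺ ⊆-refl (_ ∷ʳ ⊆-++⁺ ⊆-refl (_ ∷ʳ ⊆-refl))

filter-<-insertions : All (_< m) σ → All (λ w → filter (_<? m) w ≡ σ) (insertions m σ)
filter-<-insertions {m} {σ} σ<m =
  trans erase-m (trans erase-m keep-σ) ∷
  (begin
    filter (_<? m) (σ ++ m ∷ m ∷ [])                ≡⟨ filter-++ (_<? m) σ (m ∷ m ∷ []) ⟩
    filter (_<? m) σ ++ filter (_<? m) (m ∷ m ∷ []) ≡⟨ cong₂ _++_ keep-σ (trans erase-m erase-m) ⟩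
    σ ++ []                                          ≡⟨ ++-identityʳ σ ⟩
    σ                                                ∎) ∷
  (begin
    filter (_<? m) (m ∷ σ ++ m ∷ [])             ≡⟨ erase-m ⟩
    filter (_<? m) (σ ++ m ∷ [])                 ≡⟨ filter-++ (_<? m) σ (m ∷ []) ⟩
    filter (_<? m) σ ++ filter (_<? m) (m ∷ []) ≡⟨ cong₂ _++_ keep-σ erase-m ⟩
    σ ++ []                                      ≡⟨ ++-identityʳ σ ⟩
    σ                                            ∎) ∷ []
  where
  open ≡-Reasoning
  erase-m : ∀ {xs} → filter (_<? m) (m ∷ xs) ≡ filter (_<? m) xs
  erase-m = filter-reject (_<? m) (n≮n m)
  keep-σ : filter (_<? m) σ ≡ σ
  keep-σ = filter-all (_<? m) σ<m

insertions-disjoint : All (_< m) σ → All (_< m) τ → σ ≢ τ → Disjoint (insertions m σ) (insertions m τ)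
insertions-disjoint σ<m τ<m σ≢τ (w∈σ , w∈τ) =
  σ≢τ (trans (sym (All.lookup (filter-<-insertions σ<m) w∈σ)) (All.lookup (filter-<-insertions τ<m) w∈τ))

insertions-unique : All (_< m) σ → σ ≢ [] → Unique (insertions m σ)
insertions-unique {σ = []} _ σ≢[] = ⊥-elim (σ≢[] refl)
insertions-unique {σ = s ∷ _} (s<m ∷ _) _ =
  ((λ eq → <-irrefl (sym (∷-injectiveˡ eq)) s<m) ∷
   (λ eq → <-irrefl (sym (∷-injectiveˡ (∷-injectiveʳ eq))) s<m) ∷ []) ∷
  ((λ eq → <-irrefl (∷-injectiveˡ eq) s<m) ∷ []) ∷ [] ∷ []

concatMap-insertions-unique : ∀ {σs} → All (λ σ → All (_< m) σ × σ ≢ []) σs → Unique σs →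
                              Unique (concatMap (insertions m) σs)
concatMap-insertions-unique [] [] = []
concatMap-insertions-unique {m} {σ ∷ σs} ((σ<m , σ≢[]) ∷ valid) (σ∉ ∷ unique) =
  Unique-++⁺ (insertions-unique σ<m σ≢[]) (concatMap-insertions-unique valid unique) disjoint
  where
  disjoint : Disjoint (insertions m σ) (concatMap (insertions m) σs)
  disjoint (w∈σ , w∈σs) with find (∈-concatMap⁻ (insertions m) {xs = σs} w∈σs)
  ... | τ , τ∈ , w∈τ =
    insertions-disjoint σ<m (proj₁ (All.lookup valid τ∈)) (All.lookup σ∉ τ∈) (w∈σ , w∈τ)

↭-doubled⇒≢[] : π ↭ doubled (suc n) → π ≢ []
↭-doubled⇒≢[] {n = n} π↭ refl with ∈-resp-↭ (↭-sym π↭) (1∈doubled n)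
... | ()

qbar-unique : ∀ k → Unique (qbar k)
qbar-unique zero =
  ((λ ()) ∷ (λ ()) ∷ (λ ()) ∷ []) ∷ ((λ ()) ∷ (λ ()) ∷ []) ∷ ((λ ()) ∷ []) ∷ [] ∷ []
qbar-unique (suc k) = concatMap-insertions-unique
  (All.map (λ (π↭ , _) → All-resp-↭ (↭-sym π↭) (doubled-< (2 + k)) , ↭-doubled⇒≢[] {n = 1 + k} π↭) (qbar-sound k))
  (qbar-unique k)

length-concatMap-insertions : ∀ m σs → length (concatMap (insertions m) σs) ≡ 3 * length σs
length-concatMap-insertions m [] = refl
length-concatMap-insertions m (σ ∷ σs) =
  trans (cong (3 +_) (length-concatMap-insertions m σs)) (sym (*-suc 3 (length σs)))

length-qbar : ∀ k → length (qbar k) ≡ 4 * 3 ^ k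
length-qbar zero = refl
length-qbar (suc k) = begin
  length (qbar (suc k)) ≡⟨ length-concatMap-insertions (3 + k) (qbar k) ⟩
  3 * length (qbar k)   ≡⟨ cong (3 *_) (length-qbar k) ⟩
  3 * (4 * 3 ^ k)       ≡⟨ sym (*-assoc 3 4 (3 ^ k)) ⟩
  12 * 3 ^ k            ≡⟨ *-assoc 4 3 (3 ^ k) ⟩
  4 * (3 * 3 ^ k)       ∎
  where open ≡-Reasoning

theorem4p4 : ∀ (n : ℕ) → 2 ≤ n →
    Σ (List (List ℕ)) λ L →
      Unique L × (∀ π → π ∈ L ⇔ InQbar n (p132 ∷ p231 ∷ []) π) ×
      length L ≡ 4 * 3 ^ (n ∸ 2)
theorem4p4 (suc (suc k)) (s≤s (s≤s z≤n)) =
  qbar k , qbar-unique k ,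
  (λ π → mk⇔ (λ π∈ → from (inQbar⇔admissible {2 + k}) (All.lookup (qbar-sound k) π∈))
             (λ π∈Q → let (π↭ , adm) = to (inQbar⇔admissible {2 + k}) π∈Q in qbar-complete k π↭ adm)) ,
  length-qbar k
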